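{- Let $G=(V,E)$ be a graph, $r\ge 1$ an integer, and $k=\mathrm{adm}_r(G)$. If $\sigma$ is a total order on $V$ such that $\mathrm{est}_r(u,G_\sigma)\le k$ for all $u\in V$, then for every $u\in V$, \[ \sum_{v\in \mathrm{reach}_r(u,G_\sigma)} (k-1)^{r-d_v} \le k\cdot (k-1)^{r-1}, \] where $d_v=d_v(u,G_\sigma)$.
   Context: For a total order $\sigma$ on $V$ and vertices $u\neq v$, a $u$-$v$ path $P$ of length at most $\ell$ is an $\ell$-qualifying path if $v\not<_\sigma u$ and every $p\in P\setminus\{u,v\}$ satisfies $p<_\sigma u$; $v$ is then $\ell$-reachable from $u$. $\mathrm{reach}_r(u,G_\sigma)$ is the set of vertices $r$-reachable from $u$ (a vertex is not reachable from itself). $d_v(u,G_\sigma)$ is the minimum $i$ such that $v$ is $i$-reachable from $u$. An $\ell$-qualifying $u$-$v$ path is shortest if there is no $(\ell-1)$-qualifying $u$-$v$ path. The estimated $r$-backconnectivity $\mathrm{est}_r(u,G_\sigma)$ is the maximum number of shortest $r$-qualifying paths starting at $u$ that are pairwise vertex-disjoint except for $u$. The $r$-backconnectivity $\mathrm{bcon}_r(u,G_\sigma)$ is the maximum number of $r$-qualifying paths from $u$, pairwise disjoint except for $u$, and the $r$-admissibility is $\mathrm{adm}_r(G)=\min_\sigma\max_{u}\mathrm{bcon}_r(u,G_\sigma)$ over all total orders $\sigma$ of $V$. -}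

module Defs where

open import Data.Nat using (ℕ; zero; suc; _+_; _≤_; _<_; _∸_)
open import Data.Fin using (Fin)
open import Data.List using (List; []; _∷_; _++_; [_]; length; map)
open import Data.List.Relation.Unary.All using (All)
open import Data.List.Relation.Unary.AllPairs using (AllPairs)
open import Data.List.Relation.Unary.Unique.Propositional using (Unique)
open import Data.List.Relation.Binary.Disjoint.Propositional using (Disjoint)
open import Data.List.Membership.Propositional using (_∈_)
open import Data.Product using (Σ; _×_; _,_; ∃; ∃-syntax)
open import Relation.Nullary using (¬_)
open import Relation.Binary.PropositionalEquality using (_≡_)
open import Data.Integer as ℤ using (ℤ)
open import Function using (Injective)
open import Data.Unit using (⊤)

record Graph (n : ℕ) : Set₁ where
  field
    Adj     : Fin n → Fin n → Set
    sym     : ∀ {x y} → Adj x y → Adj y x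
    irrefl  : ∀ {x} → ¬ Adj x x
open Graph public

-- A total order σ on V = Fin n, given by an injective ranking:
-- x <σ y  iff  rank x < rank y.  (Every total order on a finite set arises so.)
record Order (n : ℕ) : Set where
  field
    rank     : Fin n → ℕ
    rank-inj : Injective _≡_ _≡_ rank
open Order public

module _ {n : ℕ} (G : Graph n) (σ : Order n) where

  Chain : Fin n → List (Fin n) → Set
  Chain x []       = ⊤
  Chain x (y ∷ ys) = Adj G x y × Chain y ys

  -- A u-v path with internal vertex list ps: u ∷ ps ++ [ v ], a path in G
  -- (distinct vertices, consecutive ones adjacent). Its length (number of edges)
  -- is length ps + 1.  It is ℓ-qualifying if its length is ≤ ℓ, v ≮σ u,
  -- and every internal vertex p satisfies p <σ u.  (u ≠ v follows from Unique.)
  QualPath : ℕ → Fin n → List (Fin n) → Fin n → Set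
  QualPath ℓ u ps v =
    Chain u (ps ++ [ v ]) ×
    Unique (u ∷ ps ++ [ v ]) ×
    suc (length ps) ≤ ℓ ×
    rank σ u ≤ rank σ v ×
    All (λ p → rank σ p < rank σ u) ps

  Reachable : ℕ → Fin n → Fin n → Set
  Reachable ℓ u v = ∃[ ps ] QualPath ℓ u ps v

  IsDist : Fin n → Fin n → ℕ → Set
  IsDist u v d = Reachable d u v × (∀ i → Reachable i u v → d ≤ i)

  -- A path from u is represented by (internal vertices , endpoint).
  PathFrom : Set
  PathFrom = List (Fin n) × Fin n

  verts : PathFrom → List (Fin n)
  verts (ps , v) = ps ++ [ v ]

  pathLength : PathFrom → ℕ
  pathLength (ps , v) = suc (length ps)

  IsQual : ℕ → Fin n → PathFrom → Set
  IsQual ℓ u (ps , v) = QualPath ℓ u ps v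

  -- shortest r-qualifying path P: P is r-qualifying and, writing ℓ = |P|,
  -- there is no (ℓ-1)-qualifying u-v path.
  IsShortestQual : ℕ → Fin n → PathFrom → Set
  IsShortestQual r u (ps , v) =
    QualPath r u ps v × ¬ Reachable (length ps) u v

  -- paths pairwise vertex-disjoint except for the common start u
  PairwiseDisjoint : List PathFrom → Set
  PairwiseDisjoint = AllPairs (λ P Q → Disjoint (verts P) (verts Q))

  BconAtMost : ℕ → Fin n → ℕ → Set
  BconAtMost r u k = ∀ (F : List PathFrom) → All (IsQual r u) F →
                     PairwiseDisjoint F → length F ≤ k

  BconAtLeast : ℕ → Fin n → ℕ → Set
  BconAtLeast r u k = ∃[ F ] (All (IsQual r u) F × PairwiseDisjoint F × k ≤ length F)

  EstAtMost : ℕ → Fin n → ℕ → Set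
  EstAtMost r u k = ∀ (F : List PathFrom) → All (IsShortestQual r u) F →
                    PairwiseDisjoint F → length F ≤ k

IsAdm : {n : ℕ} → Graph n → ℕ → ℕ → Set
IsAdm {n} G r k =
  (∃[ σ ] ∀ (u : Fin n) → BconAtMost G σ r u k) ×
  (∀ (σ : Order n) → ∃[ u ] BconAtLeast G σ r u k)

sumℤ : List ℤ → ℤ
sumℤ []       = ℤ.+ 0
sumℤ (x ∷ xs) = x ℤ.+ sumℤ xs

{-# OPTIONS --safe #-}
-- Inside an r-qualifying path from u only vertices below u occur, so a breadth-first search from u that
-- passes only through u and vertices below it yields a tree whose depth is d_v on the r-reachable vertices
-- (the targets). Keep the tree vertices that lie on a branch towards a target. A branch vertex x not above u
-- at depth j with children c_1, ..., c_m gives m shortest r-qualifying paths from x: walk down the branch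
-- through c_i and stop at the first vertex above x. They lie in disjoint subtrees, and for j >= 1 one more
-- shortest path goes up the tree towards u through vertices of depth less than j. So est_r(x) <= k bounds m
-- by k at the root and by k - 1 below it. Writing I_j, M_j and p_j for the numbers of branch vertices, branch vertices not
-- above u, and targets at depth j, this gives I_1 <= k M_0, I_(j+1) <= (k-1) M_j for j >= 1, M_0 <= 1 and
-- p_j + M_j <= I_j, and induction on j shows that the sum of p_i (k-1)^(r-i) over 1 <= i <= j plus
-- M_j (k-1)^(r-j) never exceeds k (k-1)^(r-1).
-- Building the tree needs decidable adjacency, which may be assumed since the conclusion is decidable.
module Submission where

open import Defs hiding (sym)
open import Data.Nat using (ℕ)
open import Data.Fin using (Fin)
open import Relation.Nullary using (Dec)

module Counting where

  open import Data.Nat using (zero; suc; _+_; _*_; _∸_; _^_; _≤_; _<_; z≤n; s≤s; _≤?_; _≟_)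
  open import Data.Nat.Properties
  open import Data.Nat.ListAction using (sum)
  open import Algebra.Properties.CommutativeSemigroup +-commutativeSemigroup using (x∙yz≈y∙xz)
  open import Data.List using (List; []; _∷_; length; map; filter)
  open import Data.List.Properties using (filter-none; filter-all; filter-accept; filter-reject)
  open import Data.List.Relation.Unary.All as All using (All; []; _∷_)
  open import Data.List.Relation.Unary.Any using (here; there)
  open import Data.List.Relation.Unary.Unique.Propositional using (Unique)
  open import Data.List.Relation.Unary.AllPairs using ([]; _∷_)
  open import Data.List.Membership.Propositional using (_∈_)
  open import Data.Product using (_×_; _,_; proj₂)
  open import Data.Sum using (inj₁; inj₂)
  open import Relation.Nullary using (¬_; yes; no; ¬?)
  open import Relation.Nullary.Negation using (contradiction)
  open import Relation.Unary using (Decidable)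
  open import Relation.Binary.Definitions using (DecidableEquality)
  open import Relation.Binary.PropositionalEquality using (_≡_; refl; sym; trans; cong; cong₂; subst; module ≡-Reasoning)

  record LeastBelow (P : ℕ → Set) (t : ℕ) : Set where
    field
      value   : ℕ
      value≤  : value ≤ t
      holds   : P value
      minimal : ∀ {b} → b < value → ¬ P b

  record GreatestBelow (P : ℕ → Set) (t : ℕ) : Set where
    field
      value   : ℕ
      value≤  : value ≤ t
      holds   : P value
      maximal : ∀ {b} → value < b → b ≤ t → ¬ P b

  leastBelow : ∀ {P} → Decidable P → ∀ t → P t → LeastBelow P t
  leastBelow P? t pt with P? 0
  ... | yes p0 = record { value = 0 ; value≤ = z≤n ; holds = p0 ; minimal = λ () }
  leastBelow P? zero    pt | no ¬p0 = contradiction pt ¬p0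
  leastBelow {P} P? (suc t) pt | no ¬p0 = record
    { value = suc value ; value≤ = s≤s value≤ ; holds = holds ; minimal = minimal′ }
    where
    open LeastBelow (leastBelow (λ b → P? (suc b)) t pt)
    minimal′ : ∀ {b} → b < suc value → ¬ P b
    minimal′ {zero}  _         = ¬p0
    minimal′ {suc b} (s≤s b<v) = minimal b<v

  greatestBelow : ∀ {P} → Decidable P → P 0 → ∀ t → GreatestBelow P t
  greatestBelow P? p0 zero = record
    { value = 0 ; value≤ = z≤n ; holds = p0 ; maximal = λ 0<b b≤0 → contradiction (≤-trans 0<b b≤0) λ () }
  greatestBelow {P} P? p0 (suc t) with P? (suc t)
  ... | yes pt = record
    { value = suc t ; value≤ = ≤-refl ; holds = pt ; maximal = λ t<b b≤t → contradiction (≤-trans t<b b≤t) (<-irrefl refl) }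
  ... | no ¬pt = record
    { value = value ; value≤ = m≤n⇒m≤1+n value≤ ; holds = holds ; maximal = maximal′ }
    where
    open GreatestBelow (greatestBelow P? p0 t)
    maximal′ : ∀ {b} → value < b → b ≤ suc t → ¬ P b
    maximal′ v<b b≤1+t with m≤n⇒m<n∨m≡n b≤1+t
    ... | inj₁ b<1+t = maximal v<b (≤-pred b<1+t)
    ... | inj₂ refl  = ¬pt

  module _ {A B : Set} (_≟B_ : DecidableEquality B) (f : A → B) where

    fibre : B → List A → List A
    fibre b = filter (λ a → f a ≟B b)

    private
      outside : B → List A → List A
      outside b = filter (λ a → ¬? (f a ≟B b))

      length≡fibre+outside : ∀ b As → length As ≡ length (fibre b As) + length (outside b As)
      length≡fibre+outside b [] = refl
      length≡fibre+outside b (a ∷ As) with f a ≟B b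
      ... | yes _ = cong suc (length≡fibre+outside b As)
      ... | no  _ = trans (cong suc (length≡fibre+outside b As)) (sym (+-suc _ _))

      fibre-outside≤fibre : ∀ b b′ As → length (fibre b (outside b′ As)) ≤ length (fibre b As)
      fibre-outside≤fibre b b′ [] = z≤n
      fibre-outside≤fibre b b′ (a ∷ As) with f a ≟B b′
      ... | yes _ with f a ≟B b
      ...   | yes _ = m≤n⇒m≤1+n (fibre-outside≤fibre b b′ As)
      ...   | no  _ = fibre-outside≤fibre b b′ As
      fibre-outside≤fibre b b′ (a ∷ As) | no _ with f a ≟B b
      ...   | yes _ = s≤s (fibre-outside≤fibre b b′ As)
      ...   | no  _ = fibre-outside≤fibre b b′ As

      outside-image : ∀ b Bs As → All (λ a → f a ∈ b ∷ Bs) As → All (λ a → f a ∈ Bs) (outside b As)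
      outside-image b Bs [] [] = []
      outside-image b Bs (a ∷ As) (fa∈ ∷ fAs∈) with f a ≟B b | fa∈
      ... | yes _   | _         = outside-image b Bs As fAs∈
      ... | no  fa≢b | here fa≡b = contradiction fa≡b fa≢b
      ... | no  _   | there fa∈Bs = fa∈Bs ∷ outside-image b Bs As fAs∈

    fibre-counting : ∀ c Bs As → All (λ a → f a ∈ Bs) As →
                     (∀ {b} → b ∈ Bs → length (fibre b As) ≤ c) → length As ≤ c * length Bs
    fibre-counting c []       []       _ _ = z≤n
    fibre-counting c []       (a ∷ As) (() ∷ _) _
    fibre-counting c (b ∷ Bs) As fAs∈ fibre≤c = begin
      length As                                       ≡⟨ length≡fibre+outside b As ⟩
      length (fibre b As) + length (outside b As)     ≤⟨ +-mono-≤ (fibre≤c (here refl)) rest ⟩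
      c + c * length Bs                               ≡⟨ *-suc c (length Bs) ⟨
      c * length (b ∷ Bs)                             ∎
      where
      open ≤-Reasoning
      rest : length (outside b As) ≤ c * length Bs
      rest = fibre-counting c Bs (outside b As) (outside-image b Bs As fAs∈)
               (λ b′∈ → ≤-trans (fibre-outside≤fibre _ b As) (fibre≤c (there b′∈)))

  module _ {A : Set} (_≟A_ : DecidableEquality A) where

    private
      fibre-Unique≤1 : ∀ x {As} → Unique As → length (fibre _≟A_ (λ a → a) x As) ≤ 1
      fibre-Unique≤1 x []            = z≤n
      fibre-Unique≤1 x {a ∷ _} (a∉ ∷ As!) with a ≟A x
      ... | no  _    = fibre-Unique≤1 x As!
      ... | yes refl = s≤s (≤-reflexive (cong length
                         (filter-none (λ a → a ≟A x) (All.map (λ x≢a a≡x → x≢a (sym a≡x)) a∉))))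

    Unique⇒length≤ : ∀ {As Bs} → Unique As → (∀ {x} → x ∈ As → x ∈ Bs) → length As ≤ length Bs
    Unique⇒length≤ {As} {Bs} As! As⊆Bs = subst (length As ≤_) (*-identityˡ (length Bs))
      (fibre-counting _≟A_ (λ a → a) 1 Bs As (All.tabulate As⊆Bs) (λ {x} _ → fibre-Unique≤1 x As!))

  sumTo : (ℕ → ℕ) → ℕ → ℕ
  sumTo f zero    = 0
  sumTo f (suc j) = sumTo f j + f (suc j)

  module _ {A : Set} (grade : A → ℕ) (h : ℕ → ℕ) where

    open ≡-Reasoning

    private
      weight : A → ℕ
      weight a = h (grade a)

      sumOver : {P : A → Set} → Decidable P → List A → ℕ
      sumOver P? xs = sum (map weight (filter P? xs))

      sumOver-accept : ∀ {P} (P? : Decidable P) {a xs} → P a → sumOver P? (a ∷ xs) ≡ weight a + sumOver P? xs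
      sumOver-accept P? pa = cong (λ ys → sum (map weight ys)) (filter-accept P? pa)

      sumOver-reject : ∀ {P} (P? : Decidable P) {a xs} → ¬ P a → sumOver P? (a ∷ xs) ≡ sumOver P? xs
      sumOver-reject P? ¬pa = cong (λ ys → sum (map weight ys)) (filter-reject P? ¬pa)

      below : ∀ j → Decidable (λ a → grade a ≤ j)
      below j a = grade a ≤? j

      at : ∀ j → Decidable (λ a → grade a ≡ j)
      at j a = grade a ≟ j

      sumBelow-suc : ∀ j xs → sumOver (below (suc j)) xs ≡ sumOver (below j) xs + sumOver (at (suc j)) xs
      sumBelow-suc j [] = refl
      sumBelow-suc j (a ∷ xs) with grade a ≟ suc j | grade a ≤? j
      ... | yes g≡1+j | _ = begin
        sumOver (below (suc j)) (a ∷ xs)                            ≡⟨ sumOver-accept (below (suc j)) (≤-reflexive g≡1+j) ⟩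
        weight a + sumOver (below (suc j)) xs                       ≡⟨ cong (weight a +_) (sumBelow-suc j xs) ⟩
        weight a + (sumOver (below j) xs + sumOver (at (suc j)) xs) ≡⟨ x∙yz≈y∙xz (weight a) (sumOver (below j) xs) _ ⟩
        sumOver (below j) xs + (weight a + sumOver (at (suc j)) xs) ≡⟨ cong₂ _+_ (sumOver-reject (below j) g≰j)
                                                                                 (sumOver-accept (at (suc j)) g≡1+j) ⟨
        sumOver (below j) (a ∷ xs) + sumOver (at (suc j)) (a ∷ xs)  ∎
        where
        g≰j : ¬ grade a ≤ j
        g≰j g≤j = <-irrefl refl (subst (_≤ j) g≡1+j g≤j)
      ... | no g≢1+j | yes g≤j = begin
        sumOver (below (suc j)) (a ∷ xs)                            ≡⟨ sumOver-accept (below (suc j)) (m≤n⇒m≤1+n g≤j) ⟩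
        weight a + sumOver (below (suc j)) xs                       ≡⟨ cong (weight a +_) (sumBelow-suc j xs) ⟩
        weight a + (sumOver (below j) xs + sumOver (at (suc j)) xs) ≡⟨ +-assoc (weight a) _ _ ⟨
        weight a + sumOver (below j) xs + sumOver (at (suc j)) xs   ≡⟨ cong₂ _+_ (sumOver-accept (below j) g≤j)
                                                                                 (sumOver-reject (at (suc j)) g≢1+j) ⟨
        sumOver (below j) (a ∷ xs) + sumOver (at (suc j)) (a ∷ xs)  ∎
      ... | no g≢1+j | no g≰j = begin
        sumOver (below (suc j)) (a ∷ xs)                            ≡⟨ sumOver-reject (below (suc j)) g≰1+j ⟩
        sumOver (below (suc j)) xs                                  ≡⟨ sumBelow-suc j xs ⟩
        sumOver (below j) xs + sumOver (at (suc j)) xs              ≡⟨ cong₂ _+_ (sumOver-reject (below j) g≰j)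
                                                                                 (sumOver-reject (at (suc j)) g≢1+j) ⟨
        sumOver (below j) (a ∷ xs) + sumOver (at (suc j)) (a ∷ xs)  ∎
        where
        g≰1+j : ¬ grade a ≤ suc j
        g≰1+j g≤1+j = g≰j (≤-pred (≤∧≢⇒< g≤1+j g≢1+j))

      sumAt≡count*weight : ∀ j xs → sumOver (at j) xs ≡ length (filter (at j) xs) * h j
      sumAt≡count*weight j [] = refl
      sumAt≡count*weight j (a ∷ xs) with grade a ≟ j
      ... | yes g≡j = begin
        sumOver (at j) (a ∷ xs)                    ≡⟨ sumOver-accept (at j) g≡j ⟩
        weight a + sumOver (at j) xs               ≡⟨ cong₂ _+_ (cong h g≡j) (sumAt≡count*weight j xs) ⟩
        h j + length (filter (at j) xs) * h j      ≡⟨ cong (λ ys → length ys * h j) (filter-accept (at j) g≡j) ⟨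
        length (filter (at j) (a ∷ xs)) * h j      ∎
      ... | no  g≢j = begin
        sumOver (at j) (a ∷ xs)                    ≡⟨ sumOver-reject (at j) g≢j ⟩
        sumOver (at j) xs                          ≡⟨ sumAt≡count*weight j xs ⟩
        length (filter (at j) xs) * h j            ≡⟨ cong (λ ys → length ys * h j) (filter-reject (at j) g≢j) ⟨
        length (filter (at j) (a ∷ xs)) * h j      ∎

    sum-grouped-by-grade : ∀ r xs → All (λ a → 1 ≤ grade a × grade a ≤ r) xs →
      sum (map weight xs) ≡ sumTo (λ j → length (filter (λ a → grade a ≟ j) xs) * h j) r
    sum-grouped-by-grade r xs bounds =
      trans (cong (λ ys → sum (map weight ys)) (sym (filter-all (below r) (All.map proj₂ bounds)))) (grouped r)
      where
      grouped : ∀ j → sumOver (below j) xs ≡ sumTo (λ j → length (filter (at j) xs) * h j) j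
      grouped zero    = cong (λ ys → sum (map weight ys))
                          (filter-none (below 0) (All.map (λ (1≤g , _) g≤0 → <⇒≱ 1≤g g≤0) bounds))
      grouped (suc j) = trans (sumBelow-suc j xs) (cong₂ _+_ (grouped j) (sumAt≡count*weight (suc j) xs))

  module _ (b r : ℕ) (targets inner layer : ℕ → ℕ)
           (inner₀≤1 : inner 0 ≤ 1)
           (layer₁≤ : layer 1 ≤ suc b * inner 0)
           (layer-suc≤ : ∀ j → layer (2 + j) ≤ b * inner (1 + j))
           (targets+inner≤layer : ∀ j → targets j + inner j ≤ layer j) where

    private
      weighted : ℕ → ℕ
      weighted = sumTo (λ j → targets j * b ^ (r ∸ j))

      bound : ℕ
      bound = suc b * b ^ (r ∸ 1)

      invariant : ∀ j → suc j ≤ r → weighted (suc j) + inner (suc j) * b ^ (r ∸ suc j) ≤ bound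
      invariant zero _ = begin
        weighted 1 + inner 1 * B              ≡⟨⟩
        targets 1 * B + inner 1 * B           ≡⟨ *-distribʳ-+ B (targets 1) (inner 1) ⟨
        (targets 1 + inner 1) * B             ≤⟨ *-monoˡ-≤ B (≤-trans (targets+inner≤layer 1) layer₁≤) ⟩
        suc b * inner 0 * B                   ≤⟨ *-monoˡ-≤ B (*-monoʳ-≤ (suc b) inner₀≤1) ⟩
        suc b * 1 * B                         ≡⟨ cong (_* B) (*-identityʳ (suc b)) ⟩
        bound                                 ∎
        where
        open ≤-Reasoning
        B : ℕ
        B = b ^ (r ∸ 1)
      invariant (suc j) 2+j≤r = begin
        weighted (2 + j) + inner (2 + j) * C                        ≡⟨ +-assoc (weighted (1 + j)) _ _ ⟩
        weighted (1 + j) + (targets (2 + j) * C + inner (2 + j) * C) ≡⟨ cong (weighted (1 + j) +_)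
                                                                         (*-distribʳ-+ C (targets (2 + j)) (inner (2 + j))) ⟨
        weighted (1 + j) + (targets (2 + j) + inner (2 + j)) * C     ≤⟨ +-monoʳ-≤ (weighted (1 + j))
                                                                         (*-monoˡ-≤ C (≤-trans (targets+inner≤layer (2 + j)) (layer-suc≤ j))) ⟩
        weighted (1 + j) + b * inner (1 + j) * C                     ≡⟨ cong (λ x → weighted (1 + j) + x * C) (*-comm b (inner (1 + j))) ⟩
        weighted (1 + j) + inner (1 + j) * b * C                     ≡⟨ cong (weighted (1 + j) +_) (*-assoc (inner (1 + j)) b C) ⟩
        weighted (1 + j) + inner (1 + j) * (b * C)                   ≡⟨ cong (λ e → weighted (1 + j) + inner (1 + j) * b ^ e)
                                                                         (+-∸-assoc 1 2+j≤r) ⟨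
        weighted (1 + j) + inner (1 + j) * b ^ (r ∸ suc j)           ≤⟨ invariant j (≤-trans (n≤1+n (suc j)) 2+j≤r) ⟩
        bound                                                        ∎
        where
        open ≤-Reasoning
        C : ℕ
        C = b ^ (r ∸ (2 + j))

    layered-weight-bound : 1 ≤ r → weighted r ≤ bound
    layered-weight-bound 1≤r = subst (λ j → weighted j ≤ bound) 1+[r∸1]≡r
      (≤-trans (m≤m+n (weighted (suc (r ∸ 1))) _) (invariant (r ∸ 1) (≤-reflexive 1+[r∸1]≡r)))
      where
      1+[r∸1]≡r : suc (r ∸ 1) ≡ r
      1+[r∸1]≡r = m+[n∸m]≡n 1≤r

module BreadthFirstTree {n : ℕ} (G : Graph n) (σ : Order n) (Adj? : ∀ x y → Dec (Adj G x y))
                        (u : Fin n) (r : ℕ) where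

  open import Data.Nat using (zero; suc; pred; _+_; _*_; _^_; _∸_; _≤_; _<_; z≤n; s≤s; _≤?_; _<?_; _≟_; >-nonZero)
  open import Data.Nat.Properties
  open import Data.Fin using () renaming (_≟_ to _≟ᶠ_)
  open import Data.Fin.Properties using (any?)
  open import Data.List using (List; []; _∷_; _++_; [_]; length; filter; allFin; map)
  open import Data.List.Properties using (length-++)
  open import Data.Nat.ListAction using (sum)
  open import Data.List.Membership.Propositional.Properties using (∈-filter⁻; ∈-filter⁺; ∈-allFin; ∈-++⁻)
  import Data.List.Relation.Unary.Unique.Propositional.Properties as Unique
  open import Data.List.Relation.Unary.All as All using (All; []; _∷_)
  open import Data.List.Relation.Unary.Any using (here; there)
  open import Data.List.Relation.Unary.Unique.Propositional using (Unique)
  open import Data.List.Relation.Unary.AllPairs using ([]; _∷_)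
  open import Data.List.Membership.Propositional using (_∈_)
  open import Data.List.Relation.Binary.Disjoint.Propositional using (Disjoint)
  open import Data.Product using (Σ; ∃; ∃-syntax; _×_; _,_; proj₁; proj₂)
  open import Data.Sum using (_⊎_; inj₁; inj₂)
  open import Data.Unit using (tt)
  open import Function using (case_of_)
  open import Data.Empty using (⊥-elim)
  open import Relation.Nullary using (¬_; yes; no)
  open import Relation.Nullary.Decidable using (_×-dec_; _⊎-dec_)
  open import Relation.Nullary.Negation using (contradiction)
  open import Relation.Unary using (Decidable)
  open import Relation.Binary.PropositionalEquality using (_≡_; _≢_; refl; sym; trans; cong; cong₂; subst; subst₂; module ≡-Reasoning)
  open Counting

  Low : Fin n → Set
  Low y = rank σ y ≤ rank σ u

  ReachWithin : ℕ → Fin n → Set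
  ReachWithin zero    w = w ≡ u
  ReachWithin (suc j) w = ReachWithin j w ⊎ ∃[ y ] (ReachWithin j y × Low y × Adj G y w)

  reachWithin? : ∀ j → Decidable (ReachWithin j)
  reachWithin? zero    w = w ≟ᶠ u
  reachWithin? (suc j) w = reachWithin? j w ⊎-dec
    any? (λ y → reachWithin? j y ×-dec (rank σ y ≤? rank σ u) ×-dec Adj? y w)

  private
    depthSearch : ∀ w → LeastBelow (λ j → ReachWithin j w ⊎ j ≡ suc r) (suc r)
    depthSearch w = leastBelow (λ j → reachWithin? j w ⊎-dec (j ≟ suc r)) (suc r) (inj₂ refl)

  -- depth w = suc r when w is not reached within r steps.
  opaque
    depth : Fin n → ℕ
    depth w = LeastBelow.value (depthSearch w)

    depth-minimal : ∀ {i w} → ReachWithin i w → depth w ≤ i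
    depth-minimal {i} {w} reach = ≮⇒≥ (λ i<d → LeastBelow.minimal (depthSearch w) i<d (inj₁ reach))

    depth-reach : ∀ {w} → depth w ≤ r → ReachWithin (depth w) w
    depth-reach {w} d≤r with LeastBelow.holds (depthSearch w)
    ... | inj₁ reach = reach
    ... | inj₂ d≡1+r = contradiction (subst (_≤ r) d≡1+r d≤r) (<-irrefl refl)

  depth-root : depth u ≡ 0
  depth-root = n≤0⇒n≡0 (depth-minimal {0} refl)

  depth≡0⇒root : ∀ {w} → depth w ≡ 0 → w ≡ u
  depth≡0⇒root {w} d≡0 = subst (λ j → ReachWithin j w) d≡0 (depth-reach (subst (_≤ r) (sym d≡0) z≤n))

  low-below-root : ∀ {w} → Low w → 0 < depth w → rank σ w < rank σ u
  low-below-root {w} w-low 0<d = ≤∧≢⇒< w-low λ eq → <⇒≢ 0<d (sym (trans (cong depth (rank-inj σ eq)) depth-root))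

  ParentCandidate : Fin n → Fin n → Set
  ParentCandidate w y = ReachWithin (pred (depth w)) y × Low y × Adj G y w

  parentCandidate? : ∀ w → Decidable (ParentCandidate w)
  parentCandidate? w y = reachWithin? (pred (depth w)) y ×-dec (rank σ y ≤? rank σ u) ×-dec Adj? y w

  -- parent w = w when no candidate exists, i.e. at the root and beyond depth r.
  parent : Fin n → Fin n
  parent w with any? (parentCandidate? w)
  ... | yes (y , _) = y
  ... | no  _       = w

  private
    1+pred-depth : ∀ {w} → 0 < depth w → suc (pred (depth w)) ≡ depth w
    1+pred-depth {w} 0<d = suc-pred (depth w) {{>-nonZero 0<d}}

    candidate : ∀ {w} → 0 < depth w → depth w ≤ r → ∃ (ParentCandidate w)
    candidate {w} 0<d d≤r with subst (λ j → ReachWithin j w) (sym (1+pred-depth {w} 0<d)) (depth-reach {w} d≤r)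
    ... | inj₁ reach = contradiction (depth-minimal reach) (<⇒≱ (≤-reflexive (1+pred-depth {w} 0<d)))
    ... | inj₂ cand  = cand

  parent-candidate : ∀ {w} → 0 < depth w → depth w ≤ r → ParentCandidate w (parent w)
  parent-candidate {w} 0<d d≤r with any? (parentCandidate? w)
  ... | yes (_ , cand) = cand
  ... | no  none       = ⊥-elim (none (candidate 0<d d≤r))

  depth-parent : ∀ {w} → 0 < depth w → depth w ≤ r → depth (parent w) ≡ pred (depth w)
  depth-parent {w} 0<d d≤r = ≤-antisym (depth-minimal (proj₁ cand)) (≮⇒≥ too-shallow)
    where
    cand : ParentCandidate w (parent w)
    cand = parent-candidate 0<d d≤r
    too-shallow : ¬ depth (parent w) < pred (depth w)
    too-shallow dp<d-1 = <⇒≱ (subst (suc (depth (parent w)) <_) (1+pred-depth {w} 0<d) (s≤s dp<d-1))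
      (depth-minimal (inj₂ (parent w , depth-reach {parent w} (≤-trans (≤-trans (<⇒≤ dp<d-1) pred[n]≤n) d≤r) , proj₂ cand)))

  ancestor : ℕ → Fin n → Fin n
  ancestor zero    w = w
  ancestor (suc s) w = parent (ancestor s w)

  ancestor-+ : ∀ m a v → ancestor m (ancestor a v) ≡ ancestor (m + a) v
  ancestor-+ zero    a v = refl
  ancestor-+ (suc m) a v = cong parent (ancestor-+ m a v)

  module _ {w : Fin n} (d≤r : depth w ≤ r) where

    depth-ancestor : ∀ {s} → s ≤ depth w → depth (ancestor s w) ≡ depth w ∸ s
    depth-ancestor {zero}  _     = refl
    depth-ancestor {suc s} s<d = begin
      depth (parent (ancestor s w))  ≡⟨ depth-parent 0<d (subst (_≤ r) (sym ih) (≤-trans (m∸n≤m (depth w) s) d≤r)) ⟩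
      pred (depth (ancestor s w))    ≡⟨ cong pred ih ⟩
      pred (depth w ∸ s)             ≡⟨ pred[m∸n]≡m∸[1+n] (depth w) s ⟩
      depth w ∸ suc s                ∎
      where
      open ≡-Reasoning
      ih : depth (ancestor s w) ≡ depth w ∸ s
      ih = depth-ancestor (<⇒≤ s<d)
      0<d : 0 < depth (ancestor s w)
      0<d = subst (0 <_) (sym ih) (m<n⇒0<n∸m s<d)

    depth-ancestor+ : ∀ {s} → s ≤ depth w → depth (ancestor s w) + s ≡ depth w
    depth-ancestor+ s≤d = trans (cong (_+ _) (depth-ancestor s≤d)) (m∸n+n≡m s≤d)

    depth-ancestor-gap : ∀ {a b} → a ≤ b → b ≤ depth w → depth (ancestor b w) + (b ∸ a) ≡ depth (ancestor a w)
    depth-ancestor-gap {a} {b} a≤b b≤d = +-cancelʳ-≡ a _ _ (begin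
      depth (ancestor b w) + (b ∸ a) + a   ≡⟨ +-assoc (depth (ancestor b w)) (b ∸ a) a ⟩
      depth (ancestor b w) + (b ∸ a + a)   ≡⟨ cong (depth (ancestor b w) +_) (m∸n+n≡m a≤b) ⟩
      depth (ancestor b w) + b             ≡⟨ depth-ancestor+ b≤d ⟩
      depth w                              ≡⟨ depth-ancestor+ (≤-trans a≤b b≤d) ⟨
      depth (ancestor a w) + a             ∎)
      where open ≡-Reasoning

    ancestor-depth≤r : ∀ {s} → s ≤ depth w → depth (ancestor s w) ≤ r
    ancestor-depth≤r {s} s≤d = subst (_≤ r) (sym (depth-ancestor s≤d)) (≤-trans (m∸n≤m (depth w) s) d≤r)

    private
      ancestor-0<depth : ∀ {s} → s < depth w → 0 < depth (ancestor s w)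
      ancestor-0<depth s<d = subst (0 <_) (sym (depth-ancestor (<⇒≤ s<d))) (m<n⇒0<n∸m s<d)

    ancestor-adj : ∀ {s} → s < depth w → Adj G (ancestor (suc s) w) (ancestor s w)
    ancestor-adj s<d = proj₂ (proj₂ (parent-candidate (ancestor-0<depth s<d) (ancestor-depth≤r (<⇒≤ s<d))))

    ancestor-low : ∀ {s} → s < depth w → Low (ancestor (suc s) w)
    ancestor-low s<d = proj₁ (proj₂ (parent-candidate (ancestor-0<depth s<d) (ancestor-depth≤r (<⇒≤ s<d))))

    ancestor-depth-root : ancestor (depth w) w ≡ u
    ancestor-depth-root = depth≡0⇒root (trans (depth-ancestor ≤-refl) (n∸n≡0 (depth w)))

    depth-ancestor-< : ∀ {i j} → i < j → j ≤ depth w → depth (ancestor j w) < depth (ancestor i w)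
    depth-ancestor-< i<j j≤d = subst₂ _<_ (sym (depth-ancestor j≤d)) (sym (depth-ancestor (≤-trans (<⇒≤ i<j) j≤d)))
                                  (∸-monoʳ-< i<j j≤d)

    ancestor-<-root : ∀ {s} → 0 < s → s < depth w → rank σ (ancestor s w) < rank σ u
    ancestor-<-root {suc s} _ 1+s<d = low-below-root (ancestor-low (<⇒≤ 1+s<d)) (ancestor-0<depth 1+s<d)

  reachWithin-chain : ∀ ps {x y a} → ReachWithin a x → Low x → Chain G σ x (ps ++ [ y ]) → All Low ps →
                      ReachWithin (a + suc (length ps)) y
  reachWithin-chain []       {x} {y} {a} reach low (adj , _) [] =
    subst (λ j → ReachWithin j y) (+-comm 1 a) (inj₂ (x , reach , low , adj))
  reachWithin-chain (p ∷ ps) {x} {y} {a} reach low (adj , chain) (lowp ∷ lows) =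
    subst (λ j → ReachWithin j y) (sym (+-suc a (suc (length ps))))
      (reachWithin-chain ps (inj₂ (x , reach , low , adj)) lowp chain lows)

  reachWithin-reverse-chain : ∀ qs {x y a} → ReachWithin a y → Low y → Chain G σ x (qs ++ [ y ]) → All Low qs →
                              ReachWithin (a + suc (length qs)) x
  reachWithin-reverse-chain []       {x} {y} {a} reach low (adj , _) [] =
    subst (λ j → ReachWithin j x) (+-comm 1 a) (inj₂ (y , reach , low , Graph.sym G adj))
  reachWithin-reverse-chain (q ∷ qs) {x} {y} {a} reach low (adj , chain) (lowq ∷ lows) =
    subst (λ j → ReachWithin j x) (sym (+-suc a (suc (length qs))))
      (inj₂ (q , reachWithin-reverse-chain qs reach low chain lows , lowq , Graph.sym G adj))

  depth≤path-length : ∀ {ℓ v ps} → QualPath G σ ℓ u ps v → depth v ≤ suc (length ps)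
  depth≤path-length {ps = ps} (chain , _ , _ , _ , internal<u) =
    depth-minimal (reachWithin-chain ps refl ≤-refl chain (All.map <⇒≤ internal<u))

  module _ {x y : Fin n} (x-low : Low x) where

    private
      internal-low : ∀ {qs} → All (λ p → rank σ p < rank σ x) qs → All Low qs
      internal-low = All.map (λ p<x → <⇒≤ (<-≤-trans p<x x-low))

    shortest-if-deeper : ∀ {ps : List (Fin n)} → depth x ≤ r → depth x + suc (length ps) ≤ depth y → ¬ Reachable G σ (length ps) x y
    shortest-if-deeper {ps} d≤r deep (qs , chain , _ , qs<ps , _ , internal<x) = <⇒≱
      (≤-trans (+-monoʳ-< (depth x) (s≤s qs<ps)) deep)
      (depth-minimal (reachWithin-chain qs (depth-reach d≤r) x-low chain (internal-low internal<x)))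

    shortest-if-shallower : ∀ {ps : List (Fin n)} → Low y → depth y ≤ r → depth y + suc (length ps) ≤ depth x →
                            ¬ Reachable G σ (length ps) x y
    shortest-if-shallower {ps} y-low d≤r shallow (qs , chain , _ , qs<ps , _ , internal<x) = <⇒≱
      (≤-trans (+-monoʳ-< (depth y) (s≤s qs<ps)) shallow)
      (depth-minimal (reachWithin-reverse-chain qs (depth-reach d≤r) y-low chain (internal-low internal<x)))

  -- descent v a m lists ancestor (a + m - 1) v, ..., ancestor a v; ascent x a m the reverse for x.
  descent : Fin n → ℕ → ℕ → List (Fin n)
  descent v a zero    = []
  descent v a (suc m) = ancestor (a + m) v ∷ descent v a m

  ascent : Fin n → ℕ → ℕ → List (Fin n)
  ascent x a zero    = []
  ascent x a (suc m) = ancestor a x ∷ ascent x (suc a) m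

  descent-suc : ∀ v a m → descent v a (suc m) ≡ descent v (suc a) m ++ [ ancestor a v ]
  descent-suc v a zero    = cong (λ i → ancestor i v ∷ []) (+-identityʳ a)
  descent-suc v a (suc m) = cong₂ _∷_ (cong (λ i → ancestor i v) (+-suc a m)) (descent-suc v a m)

  ascent-suc : ∀ x a m → ascent x a (suc m) ≡ ascent x a m ++ [ ancestor (a + m) x ]
  ascent-suc x a zero    = cong (λ i → ancestor i x ∷ []) (sym (+-identityʳ a))
  ascent-suc x a (suc m) = cong (ancestor a x ∷_)
    (trans (ascent-suc x (suc a) m) (cong (λ i → ascent x (suc a) m ++ [ ancestor i x ]) (sym (+-suc a m))))

  length-descent : ∀ v a m → length (descent v a m) ≡ m
  length-descent v a zero    = refl
  length-descent v a (suc m) = cong suc (length-descent v a m)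

  length-ascent : ∀ x a m → length (ascent x a m) ≡ m
  length-ascent x a zero    = refl
  length-ascent x a (suc m) = cong suc (length-ascent x (suc a) m)

  AncestorBetween : Fin n → ℕ → ℕ → Fin n → Set
  AncestorBetween v a b y = ∃[ i ] (a ≤ i × i < b × y ≡ ancestor i v)

  ∈-descent : ∀ {v a m y} → y ∈ descent v a m → AncestorBetween v a (a + m) y
  ∈-descent {v} {a} {suc m} (here y≡) = a + m , m≤m+n a m , ≤-reflexive (sym (+-suc a m)) , y≡
  ∈-descent {v} {a} {suc m} (there y∈) with ∈-descent y∈
  ... | i , a≤i , i<a+m , y≡ = i , a≤i , ≤-trans i<a+m (+-monoʳ-≤ a (n≤1+n m)) , y≡

  ∈-ascent : ∀ {x a m y} → y ∈ ascent x a m → AncestorBetween x a (a + m) y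
  ∈-ascent {x} {a} {suc m} (here y≡) = a , ≤-refl , m<m+n a (s≤s z≤n) , y≡
  ∈-ascent {x} {a} {suc m} (there y∈) with ∈-ascent y∈
  ... | i , 1+a≤i , i<1+a+m , y≡ = i , ≤-trans (n≤1+n a) 1+a≤i , subst (i <_) (sym (+-suc a m)) i<1+a+m , y≡

  module _ {w : Fin n} (d≤r : depth w ≤ r) where

    private
      descent-chain : ∀ a m → a + m ≤ depth w → Chain G σ (ancestor (a + m) w) (descent w a m)
      descent-chain a zero    _         = tt
      descent-chain a (suc m) a+1+m≤d =
        subst (λ i → Adj G (ancestor i w) (ancestor (a + m) w)) (sym (+-suc a m))
              (ancestor-adj d≤r (subst (_≤ depth w) (+-suc a m) a+1+m≤d)) ,
        descent-chain a m (≤-trans (+-monoʳ-≤ a (n≤1+n m)) a+1+m≤d)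

      descent-unique : ∀ a m → a + m ≤ depth w → Unique (ancestor (a + m) w ∷ descent w a m)
      descent-unique a zero    _         = [] ∷ []
      descent-unique a (suc m) a+1+m≤d =
        All.tabulate top≢ ∷ descent-unique a m (≤-trans (+-monoʳ-≤ a (n≤1+n m)) a+1+m≤d)
        where
        top≢ : ∀ {y} → y ∈ ancestor (a + m) w ∷ descent w a m → ancestor (a + suc m) w ≢ y
        top≢ (here refl) eq = <⇒≢ (depth-ancestor-< d≤r (≤-reflexive (sym (+-suc a m))) a+1+m≤d) (cong depth eq)
        top≢ (there y∈) eq with ∈-descent y∈
        ... | i , _ , i<a+m , refl =
          <⇒≢ (depth-ancestor-< d≤r (≤-trans i<a+m (+-monoʳ-≤ a (n≤1+n m))) a+1+m≤d) (cong depth eq)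

      ascent-chain : ∀ a m → a + m ≤ depth w → Chain G σ (ancestor a w) (ascent w (suc a) m)
      ascent-chain a zero    _         = tt
      ascent-chain a (suc m) a+1+m≤d =
        Graph.sym G (ancestor-adj d≤r (≤-trans (s≤s (m≤m+n a m)) (subst (_≤ depth w) (+-suc a m) a+1+m≤d))) ,
        ascent-chain (suc a) m (subst (_≤ depth w) (+-suc a m) a+1+m≤d)

      ascent-unique : ∀ a m → a + m ≤ depth w → Unique (ancestor a w ∷ ascent w (suc a) m)
      ascent-unique a zero    _         = [] ∷ []
      ascent-unique a (suc m) a+1+m≤d =
        All.tabulate bottom≢ ∷ ascent-unique (suc a) m (subst (_≤ depth w) (+-suc a m) a+1+m≤d)
        where
        bottom≢ : ∀ {y} → y ∈ ascent w (suc a) (suc m) → ancestor a w ≢ y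
        bottom≢ y∈ eq with ∈-ascent y∈
        ... | i , a<i , i<2+a+m , refl =
          <⇒≢ (depth-ancestor-< d≤r a<i (≤-trans (≤-pred i<2+a+m) a+1+m≤d)) (sym (cong depth eq))

    descent-path : ∀ a m → a + suc m ≤ depth w →
                   Chain G σ (ancestor (a + suc m) w) (descent w (suc a) m ++ [ ancestor a w ]) ×
                   Unique (ancestor (a + suc m) w ∷ descent w (suc a) m ++ [ ancestor a w ])
    descent-path a m a+1+m≤d = subst (λ ps → Chain G σ (ancestor (a + suc m) w) ps × Unique (ancestor (a + suc m) w ∷ ps))
                                 (descent-suc w a m)
                                 (descent-chain a (suc m) a+1+m≤d , descent-unique a (suc m) a+1+m≤d)

    ascent-path : ∀ m → suc m ≤ depth w →
                  Chain G σ w (ascent w 1 m ++ [ ancestor (suc m) w ]) × Unique (w ∷ ascent w 1 m ++ [ ancestor (suc m) w ])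
    ascent-path m 1+m≤d = subst (λ ps → Chain G σ w ps × Unique (w ∷ ps)) (ascent-suc w 1 m)
                            (ascent-chain 0 (suc m) 1+m≤d , ascent-unique 0 (suc m) 1+m≤d)

  tree-path : ∀ {v} → rank σ u ≤ rank σ v → 0 < depth v → depth v ≤ r → Reachable G σ (depth v) u v
  tree-path {v} u≤v 0<d d≤r = subst (λ t → Reachable G σ t u v) 1+m≡d
    (descent v 1 m , proj₁ chain×unique , proj₂ chain×unique , ≤-reflexive (cong suc (length-descent v 1 m)) ,
                     u≤v , internal<u)
    where
    m : ℕ
    m = depth v ∸ 1
    1+m≡d : suc m ≡ depth v
    1+m≡d = m+[n∸m]≡n 0<d
    1+m≤d : suc m ≤ depth v
    1+m≤d = ≤-reflexive 1+m≡d
    top≡u : ancestor (suc m) v ≡ u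
    top≡u = trans (cong (λ i → ancestor i v) 1+m≡d) (ancestor-depth-root {v} d≤r)
    chain×unique : Chain G σ u (descent v 1 m ++ [ v ]) × Unique (u ∷ descent v 1 m ++ [ v ])
    chain×unique = subst (λ x → Chain G σ x (descent v 1 m ++ [ v ]) × Unique (x ∷ descent v 1 m ++ [ v ])) top≡u
                     (descent-path {v} d≤r 0 m 1+m≤d)
    internal<u : All (λ p → rank σ p < rank σ u) (descent v 1 m)
    internal<u = All.tabulate λ p∈ → case ∈-descent p∈ of λ where
      (i , 1≤i , i<1+m , refl) → ancestor-<-root {v} d≤r 1≤i (subst (i <_) 1+m≡d i<1+m)

  Target : Fin n → Set
  Target v = rank σ u < rank σ v × depth v ≤ r

  DescendantsOf : Fin n → PathFrom G σ → Set
  DescendantsOf c P = ∀ {y} → y ∈ verts G σ P → ∃[ m ] (ancestor m y ≡ c × depth y ≡ depth c + m)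

  descendant-of-ancestor : ∀ {v T i} → depth v ≤ r → T ≤ depth v → i ≤ T →
                           ∃[ m ] (ancestor m (ancestor i v) ≡ ancestor T v × depth (ancestor i v) ≡ depth (ancestor T v) + m)
  descendant-of-ancestor {v} {T} {i} d≤r T≤d i≤T =
    T ∸ i , trans (ancestor-+ (T ∸ i) i v) (cong (λ s → ancestor s v) (m∸n+n≡m i≤T)) ,
    sym (depth-ancestor-gap {v} d≤r i≤T T≤d)

  -- From ancestor (suc T) v walk down the branch towards v and stop at the first vertex above the start.
  down-path : ∀ {v T} → Target v → T < depth v → Low (ancestor (suc T) v) →
              Σ (PathFrom G σ) λ P → IsShortestQual G σ r (ancestor (suc T) v) P × DescendantsOf (ancestor T v) P
  down-path {v} {T} (u<v , d≤r) T<d x-low =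
    (ps , end) , ((proj₁ chain×unique , proj₂ chain×unique , length≤ , <⇒≤ holds , internal<x) , shortest) , descendants
    where
    x : Fin n
    x = ancestor (suc T) v
    open GreatestBelow (greatestBelow (λ a → rank σ x <? rank σ (ancestor a v)) (≤-<-trans x-low u<v) T)
      renaming (value to a; value≤ to a≤T)
    m : ℕ
    m = T ∸ a
    ps : List (Fin n)
    ps = descent v (suc a) m
    end : Fin n
    end = ancestor a v
    a+m≡T : a + m ≡ T
    a+m≡T = m+[n∸m]≡n a≤T
    a+1+m≡1+T : a + suc m ≡ suc T
    a+1+m≡1+T = trans (+-suc a m) (cong suc a+m≡T)
    chain×unique : Chain G σ x (ps ++ [ end ]) × Unique (x ∷ ps ++ [ end ])
    chain×unique = subst (λ y → Chain G σ y (ps ++ [ end ]) × Unique (y ∷ ps ++ [ end ])) (cong (λ s → ancestor s v) a+1+m≡1+T)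
                     (descent-path {v} d≤r a m (subst (_≤ depth v) (sym a+1+m≡1+T) T<d))
    length≤ : suc (length ps) ≤ r
    length≤ = subst (λ l → suc l ≤ r) (sym (length-descent v (suc a) m)) (≤-trans (s≤s (m∸n≤m T a)) (≤-trans T<d d≤r))
    internal<x : All (λ p → rank σ p < rank σ x) ps
    internal<x = All.tabulate λ p∈ → case ∈-descent p∈ of λ where
      (i , a<i , i<1+a+m , refl) →
        let i≤T = ≤-pred (subst (λ t → i < suc t) a+m≡T i<1+a+m) in
        ≤∧≢⇒< (≮⇒≥ (maximal a<i i≤T)) λ eq →
          <⇒≢ (depth-ancestor-< {v} d≤r (s≤s i≤T) T<d) (cong depth (sym (rank-inj σ eq)))
    deep : depth x + suc (length ps) ≤ depth end
    deep = ≤-reflexive (begin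
      depth x + suc (length ps)   ≡⟨ cong (λ l → depth x + suc l) (length-descent v (suc a) m) ⟩
      depth x + suc (T ∸ a)       ≡⟨ cong (depth x +_) (+-∸-assoc 1 a≤T) ⟨
      depth x + (suc T ∸ a)       ≡⟨ depth-ancestor-gap {v} d≤r (m≤n⇒m≤1+n a≤T) T<d ⟩
      depth end                   ∎)
      where open ≡-Reasoning
    shortest : ¬ Reachable G σ (length ps) x end
    shortest = shortest-if-deeper {x} {end} x-low {ps} (ancestor-depth≤r {v} d≤r T<d) deep
    descendants : DescendantsOf (ancestor T v) (ps , end)
    descendants y∈ with ∈-descent (subst (_ ∈_) (sym (descent-suc v a m)) y∈)
    ... | i , _ , i<a+1+m , refl =
      descendant-of-ancestor d≤r (<⇒≤ T<d) (≤-pred (subst (i <_) a+1+m≡1+T i<a+1+m))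

  -- From x walk up the tree and stop at the first vertex above x (the root u at the latest).
  up-path : ∀ {x} → 0 < depth x → depth x ≤ r → Low x →
            Σ (PathFrom G σ) λ P → IsShortestQual G σ r x P × (∀ {y} → y ∈ verts G σ P → depth y < depth x)
  up-path {x} 0<d d≤r x-low =
    (ps , end) , ((proj₁ chain×unique , proj₂ chain×unique , length≤ , <⇒≤ holds , internal<x) , shortest) , shallower
    where
    x<u : rank σ x < rank σ u
    x<u = low-below-root x-low 0<d
    top : ℕ
    top = depth x ∸ 1
    1+top≡d : suc top ≡ depth x
    1+top≡d = m+[n∸m]≡n 0<d
    root-above-x : rank σ x < rank σ (ancestor (suc top) x)
    root-above-x = subst (λ y → rank σ x < rank σ y)
                     (sym (trans (cong (λ i → ancestor i x) 1+top≡d) (ancestor-depth-root {x} d≤r))) x<u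
    open LeastBelow (leastBelow (λ s → rank σ x <? rank σ (ancestor (suc s) x)) top root-above-x)
      renaming (value to s; value≤ to s≤top)
    ps : List (Fin n)
    ps = ascent x 1 s
    end : Fin n
    end = ancestor (suc s) x
    s<d : s < depth x
    s<d = subst (s <_) 1+top≡d (s≤s s≤top)
    chain×unique : Chain G σ x (ps ++ [ end ]) × Unique (x ∷ ps ++ [ end ])
    chain×unique = ascent-path {x} d≤r s s<d
    length≤ : suc (length ps) ≤ r
    length≤ = subst (λ l → suc l ≤ r) (sym (length-ascent x 1 s)) (≤-trans s<d d≤r)
    internal<x : All (λ p → rank σ p < rank σ x) ps
    internal<x = All.tabulate λ p∈ → case ∈-ascent p∈ of λ where
      (suc i , _ , s≤s i<s , refl) → ≤∧≢⇒< (≮⇒≥ (minimal i<s)) λ eq →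
        <⇒≢ (depth-ancestor-< {x} d≤r (s≤s z≤n) (≤-trans (s≤s (<⇒≤ i<s)) s<d)) (cong depth (rank-inj σ eq))
    shortest : ¬ Reachable G σ (length ps) x end
    shortest = shortest-if-shallower {x} {end} x-low {ps} (ancestor-low {x} d≤r s<d) (ancestor-depth≤r {x} d≤r s<d)
      (≤-reflexive (trans (cong (λ l → depth end + suc l) (length-ascent x 1 s)) (depth-ancestor+ {x} d≤r s<d)))
    shallower : ∀ {y} → y ∈ ps ++ [ end ] → depth y < depth x
    shallower y∈ with ∈-ascent (subst (_ ∈_) (sym (ascent-suc x 1 s)) y∈)
    ... | i , 1≤i , i<2+s , refl = depth-ancestor-< {x} d≤r 1≤i (≤-trans (≤-pred i<2+s) s<d)

  OnBranch : Fin n → Set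
  OnBranch w = ∃[ v ] (Target v × ∃[ t ] (t < suc (depth v) × ancestor t v ≡ w))

  onBranch? : Decidable OnBranch
  onBranch? w = any? λ v → ((rank σ u <? rank σ v) ×-dec (depth v ≤? r)) ×-dec
                           anyUpTo? (λ t → ancestor t v ≟ᶠ w) (suc (depth v))

  layer : ℕ → List (Fin n)
  layer j = filter (λ w → (depth w ≟ j) ×-dec onBranch? w) (allFin n)

  innerLayer : ℕ → List (Fin n)
  innerLayer j = filter (λ w → rank σ w ≤? rank σ u) (layer j)

  ∈-layer⁻ : ∀ {j w} → w ∈ layer j → depth w ≡ j × OnBranch w
  ∈-layer⁻ w∈ = proj₂ (∈-filter⁻ (λ w → (depth w ≟ _) ×-dec onBranch? w) {xs = allFin n} w∈)

  ∈-layer⁺ : ∀ {j w} → depth w ≡ j → OnBranch w → w ∈ layer j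
  ∈-layer⁺ {w = w} d≡j branch = ∈-filter⁺ (λ w → (depth w ≟ _) ×-dec onBranch? w) (∈-allFin w) (d≡j , branch)

  ∈-innerLayer⁻ : ∀ {j w} → w ∈ innerLayer j → w ∈ layer j × Low w
  ∈-innerLayer⁻ = ∈-filter⁻ (λ w → rank σ w ≤? rank σ u)

  layer-unique : ∀ j → Unique (layer j)
  layer-unique j = Unique.filter⁺ (λ w → (depth w ≟ j) ×-dec onBranch? w) (Unique.allFin⁺ n)

  innerLayer-unique : ∀ j → Unique (innerLayer j)
  innerLayer-unique j = Unique.filter⁺ (λ w → rank σ w ≤? rank σ u) (layer-unique j)

  onBranch-depth≤r : ∀ {w} → OnBranch w → depth w ≤ r
  onBranch-depth≤r (v , (_ , d≤r) , t , t<1+d , refl) = ancestor-depth≤r {v} d≤r (≤-pred t<1+d)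

  private
    branch-index<depth : ∀ {c v t} → depth v ≤ r → ancestor t v ≡ c → t ≤ depth v → 0 < depth c → t < depth v
    branch-index<depth {c} {v} {t} d≤r refl t≤d 0<d = subst (t <_) (depth-ancestor+ {v} d≤r t≤d) (+-monoˡ-≤ t 0<d)

  parent-∈-innerLayer : ∀ {j c} → c ∈ layer (suc j) → parent c ∈ innerLayer j
  parent-∈-innerLayer {j} {c} c∈ with ∈-layer⁻ c∈
  ... | d≡1+j , branch@(v , target@(_ , d≤r) , t , t<1+d , anc≡c) =
    ∈-filter⁺ (λ w → rank σ w ≤? rank σ u) (∈-layer⁺ depth-parent≡j branch′)
              (proj₁ (proj₂ (parent-candidate 0<d (onBranch-depth≤r branch))))
    where
    0<d : 0 < depth c
    0<d = subst (0 <_) (sym d≡1+j) (s≤s z≤n)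
    depth-parent≡j : depth (parent c) ≡ j
    depth-parent≡j = trans (depth-parent 0<d (onBranch-depth≤r branch)) (cong pred d≡1+j)
    branch′ : OnBranch (parent c)
    branch′ = v , target , suc t , s≤s (branch-index<depth d≤r anc≡c (≤-pred t<1+d) 0<d) , cong parent anc≡c

  children : Fin n → ℕ → List (Fin n)
  children x j = fibre _≟ᶠ_ parent x (layer (suc j))

  DownPath : Fin n → Fin n → Set
  DownPath x c = Σ (PathFrom G σ) λ P → IsShortestQual G σ r x P × DescendantsOf c P

  child-down-path : ∀ {x j c} → Low x → c ∈ children x j → DownPath x c
  child-down-path {x} {j} {c} x-low c∈ with ∈-filter⁻ (λ c → parent c ≟ᶠ x) {xs = layer (suc j)} c∈
  ... | c∈layer , refl with ∈-layer⁻ c∈layer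
  ... | d≡1+j , (v , target@(_ , d≤r) , t , t<1+d , refl) =
    down-path target t<d x-low
    where
    t<d : t < depth v
    t<d = branch-index<depth d≤r refl (≤-pred t<1+d) (subst (0 <_) (sym d≡1+j) (s≤s z≤n))

  descendants-disjoint : ∀ {c c′ P Q} → c ≢ c′ → depth c ≡ depth c′ → DescendantsOf c P → DescendantsOf c′ Q →
                         Disjoint (verts G σ P) (verts G σ Q)
  descendants-disjoint {c} c≢c′ d≡d′ below-c below-c′ (y∈P , y∈Q) with below-c y∈P | below-c′ y∈Q
  ... | m , anc≡c , d≡d+m | m′ , anc≡c′ , d≡d′+m′ =
    c≢c′ (trans (sym anc≡c) (trans (cong (λ i → ancestor i _) m≡m′) anc≡c′))
    where
    m≡m′ : m ≡ m′
    m≡m′ = +-cancelˡ-≡ (depth c) m m′ (trans (sym d≡d+m) (trans d≡d′+m′ (cong (_+ m′) (sym d≡d′))))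

  module _ {x : Fin n} where

    pathsOf : ∀ {L} → All (DownPath x) L → List (PathFrom G σ)
    pathsOf = All.reduce proj₁

    length-pathsOf : ∀ {L} (downs : All (DownPath x) L) → length (pathsOf downs) ≡ length L
    length-pathsOf []           = refl
    length-pathsOf (_ ∷ downs) = cong suc (length-pathsOf downs)

    pathsOf-shortest : ∀ {L} (downs : All (DownPath x) L) → All (IsShortestQual G σ r x) (pathsOf downs)
    pathsOf-shortest []                        = []
    pathsOf-shortest ((_ , shortest , _) ∷ downs) = shortest ∷ pathsOf-shortest downs

    pathsOf-disjoint : ∀ {j L} → Unique L → All (λ c → depth c ≡ j) L → (downs : All (DownPath x) L) →
                       PairwiseDisjoint G σ (pathsOf downs)
    pathsOf-disjoint []           []             []             = []
    pathsOf-disjoint {j} {c ∷ _} (c∉ ∷ L!) (dc≡j ∷ ds≡j) (down ∷ downs) =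
      disjoint-from-rest c∉ ds≡j downs ∷ pathsOf-disjoint L! ds≡j downs
      where
      disjoint-from-rest : ∀ {L} → All (c ≢_) L → All (λ c′ → depth c′ ≡ j) L → (downs : All (DownPath x) L) →
                           All (λ Q → Disjoint (verts G σ (proj₁ down)) (verts G σ Q)) (pathsOf downs)
      disjoint-from-rest []           []               []               = []
      disjoint-from-rest (c≢c′ ∷ c≢s) (dc′≡j ∷ ds′≡j) (down′ ∷ downs′) =
        descendants-disjoint c≢c′ (trans dc≡j (sym dc′≡j)) (proj₂ (proj₂ down)) (proj₂ (proj₂ down′)) ∷
        disjoint-from-rest c≢s ds′≡j downs′

    shallower-disjoint : ∀ {j P L} → (∀ {y} → y ∈ verts G σ P → depth y < depth x) → depth x ≡ j →
                         All (λ c → depth c ≡ suc j) L → (downs : All (DownPath x) L) →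
                         All (λ Q → Disjoint (verts G σ P) (verts G σ Q)) (pathsOf downs)
    shallower-disjoint shallower d≡j []               []                          = []
    shallower-disjoint {j} {L = c ∷ _} shallower d≡j (dc≡1+j ∷ ds≡) ((_ , _ , below-c) ∷ downs) =
      (λ {y} (y∈P , y∈Q) → case below-c y∈Q of λ where
        (m , _ , dy≡dc+m) → <⇒≱ (shallower y∈P) (begin
          depth x          ≡⟨ d≡j ⟩
          j                ≤⟨ n≤1+n j ⟩
          suc j            ≡⟨ dc≡1+j ⟨
          depth c          ≤⟨ m≤m+n (depth c) m ⟩
          depth c + m      ≡⟨ dy≡dc+m ⟨
          depth y          ∎))
      ∷ shallower-disjoint shallower d≡j ds≡ downs
      where open ≤-Reasoning

  module _ {x : Fin n} {j : ℕ} (x-low : Low x) where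

    private
      downs : All (DownPath x) (children x j)
      downs = All.tabulate (child-down-path x-low)

      children-unique : Unique (children x j)
      children-unique = Unique.filter⁺ (λ c → parent c ≟ᶠ x) (layer-unique (suc j))

      children-depth : All (λ c → depth c ≡ suc j) (children x j)
      children-depth = All.tabulate λ c∈ → proj₁ (∈-layer⁻ (proj₁ (∈-filter⁻ (λ c → parent c ≟ᶠ x) c∈)))

    children≤ : ∀ {k} → EstAtMost G σ r x k → length (children x j) ≤ k
    children≤ {k} est = subst (_≤ k) (length-pathsOf downs)
      (est (pathsOf downs) (pathsOf-shortest downs) (pathsOf-disjoint children-unique children-depth downs))

    1+children≤ : ∀ {k} → EstAtMost G σ r x k → depth x ≡ j → 0 < depth x → depth x ≤ r →
                  suc (length (children x j)) ≤ k
    1+children≤ {k} est d≡j 0<d d≤r = subst (λ l → suc l ≤ k) (length-pathsOf downs)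
      (est (proj₁ up ∷ pathsOf downs) (proj₁ (proj₂ up) ∷ pathsOf-shortest downs)
           (shallower-disjoint (proj₂ (proj₂ up)) d≡j children-depth downs ∷
            pathsOf-disjoint children-unique children-depth downs))
      where
      up : Σ (PathFrom G σ) λ P → IsShortestQual G σ r x P × (∀ {y} → y ∈ verts G σ P → depth y < depth x)
      up = up-path 0<d d≤r x-low

  layer-suc≤ : ∀ {c j} → (∀ {x} → x ∈ innerLayer j → length (children x j) ≤ c) →
               length (layer (suc j)) ≤ c * length (innerLayer j)
  layer-suc≤ {c} {j} children≤c =
    fibre-counting _≟ᶠ_ parent c (innerLayer j) (layer (suc j)) (All.tabulate parent-∈-innerLayer) children≤c

  innerLayer-zero≤1 : length (innerLayer 0) ≤ 1
  innerLayer-zero≤1 = Unique⇒length≤ _≟ᶠ_ {Bs = u ∷ []} (innerLayer-unique 0)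
    λ w∈ → here (depth≡0⇒root (proj₁ (∈-layer⁻ (proj₁ (∈-innerLayer⁻ w∈)))))

  target-depth>0 : ∀ {v} → Target v → 0 < depth v
  target-depth>0 (u<v , _) = ≤∧≢⇒< z≤n λ 0≡d → <⇒≢ u<v (cong (rank σ) (sym (depth≡0⇒root (sym 0≡d))))

  targets+inner≤layer : ∀ {R} → Unique R → All Target R → ∀ j →
                        length (filter (λ v → depth v ≟ j) R) + length (innerLayer j) ≤ length (layer j)
  targets+inner≤layer {R} R! targets j = subst (_≤ length (layer j)) (length-++ targetsAt)
    (Unique⇒length≤ _≟ᶠ_ (Unique.++⁺ (Unique.filter⁺ (λ v → depth v ≟ j) R!) (innerLayer-unique j) disjoint) ⊆layer)
    where
    targetsAt : List (Fin n)
    targetsAt = filter (λ v → depth v ≟ j) R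
    ∈-targetsAt⁻ : ∀ {v} → v ∈ targetsAt → Target v × depth v ≡ j
    ∈-targetsAt⁻ v∈ with ∈-filter⁻ (λ v → depth v ≟ j) {xs = R} v∈
    ... | v∈R , d≡j = All.lookup targets v∈R , d≡j
    disjoint : Disjoint targetsAt (innerLayer j)
    disjoint (v∈targets , v∈inner) = <⇒≱ (proj₁ (proj₁ (∈-targetsAt⁻ v∈targets))) (proj₂ (∈-innerLayer⁻ v∈inner))
    ⊆layer : ∀ {v} → v ∈ targetsAt ++ innerLayer j → v ∈ layer j
    ⊆layer {v} v∈ with ∈-++⁻ targetsAt v∈
    ... | inj₁ v∈targets = let target , d≡j = ∈-targetsAt⁻ v∈targets in
                           ∈-layer⁺ d≡j (v , target , 0 , s≤s z≤n , refl)
    ... | inj₂ v∈inner   = proj₁ (∈-innerLayer⁻ v∈inner)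

  weighted-targets≤ : ∀ b → (∀ x → EstAtMost G σ r x (suc b)) → 1 ≤ r → ∀ {R} → Unique R → All Target R →
                      sum (map (λ v → b ^ (r ∸ depth v)) R) ≤ suc b * b ^ (r ∸ 1)
  weighted-targets≤ b est 1≤r {R} R! targets = begin
    sum (map (λ v → b ^ (r ∸ depth v)) R)                                 ≡⟨ sum-grouped-by-grade depth (λ j → b ^ (r ∸ j)) r R
                                                                             (All.map (λ t → target-depth>0 t , proj₂ t) targets) ⟩
    sumTo (λ j → length (filter (λ v → depth v ≟ j) R) * b ^ (r ∸ j)) r   ≤⟨ layered-weight-bound b r
                                                                               (λ j → length (filter (λ v → depth v ≟ j) R))
                                                                               (λ j → length (innerLayer j)) (λ j → length (layer j))
                                                                               innerLayer-zero≤1 layer-one≤ layer-suc-suc≤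
                                                                               (targets+inner≤layer R! targets) 1≤r ⟩
    suc b * b ^ (r ∸ 1)                                                   ∎
    where
    open ≤-Reasoning
    layer-one≤ : length (layer 1) ≤ suc b * length (innerLayer 0)
    layer-one≤ = layer-suc≤ λ x∈ → children≤ (proj₂ (∈-innerLayer⁻ x∈)) (est _)
    layer-suc-suc≤ : ∀ j → length (layer (2 + j)) ≤ b * length (innerLayer (1 + j))
    layer-suc-suc≤ j = layer-suc≤ λ {x} x∈ →
      let x∈layer , x-low = ∈-innerLayer⁻ x∈
          d≡1+j , branch = ∈-layer⁻ x∈layer
      in ≤-pred (1+children≤ x-low (est x) d≡1+j (subst (0 <_) (sym d≡1+j) (s≤s z≤n)) (onBranch-depth≤r branch))

open import Data.Nat as ℕ using (_≤_; _∸_; zero; suc; z≤n)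
open import Data.Nat.Properties using (≤-trans; <⇒≤; <⇒≱; ≤∧≢⇒<; ≤-antisym)
open import Data.Nat.ListAction using (sum)
open import Data.Integer as ℤ using (+_; _-_; _*_; _^_) renaming (_≤_ to _≤ℤ_)
open import Data.Integer.Properties using (pos-+; pos-*)
open import Data.Fin using (zero; suc)
open import Data.List using (List; []; _∷_; map; length)
open import Data.List.Properties using (map-cong; map-cong-local)
open import Data.List.Membership.Propositional using (_∈_)
open import Data.List.Membership.Propositional.Properties using (∈-++⁺ʳ)
open import Data.List.Relation.Unary.All as All using (All; []; _∷_)
open import Data.List.Relation.Unary.AllPairs using ([]; _∷_)
open import Data.List.Relation.Unary.Any using (here)
open import Data.List.Relation.Unary.Unique.Propositional using (Unique)
open import Data.Product using (Σ; _×_; _,_; proj₁; proj₂)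
open import Data.Empty using (⊥; ⊥-elim)
open import Function.Bundles using (_⇔_; Equivalence)
open import Relation.Nullary using (¬_)
open import Relation.Nullary.Decidable using (decidable-stable; ¬¬-excluded-middle)
open import Relation.Binary.PropositionalEquality using (_≡_; refl; sym; trans; cong; subst; subst₂)

¬¬-∀-Fin : ∀ {m} {P : Fin m → Set} → (∀ i → ¬ ¬ P i) → ¬ ¬ (∀ i → P i)
¬¬-∀-Fin {zero}      _    ¬∀ = ¬∀ λ ()
¬¬-∀-Fin {suc m} {P} ¬¬P ¬∀ = ¬¬P zero λ P0 → ¬¬-∀-Fin (λ i → ¬¬P (suc i)) λ P-suc →
  ¬∀ λ { zero → P0 ; (suc i) → P-suc i }

¬¬-Adj-decidable : ∀ {n} (G : Graph n) → ¬ ¬ (∀ x y → Dec (Adj G x y))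
¬¬-Adj-decidable G = ¬¬-∀-Fin λ x → ¬¬-∀-Fin λ y → ¬¬-excluded-middle

pos-^ : ∀ b e → + (b ℕ.^ e) ≡ (+ b) ^ e
pos-^ b zero    = refl
pos-^ b (suc e) = trans (pos-* b (b ℕ.^ e)) (cong (+ b *_) (pos-^ b e))

sumℤ-map-pos : ∀ {A : Set} (f : A → ℕ) xs → sumℤ (map (λ x → + f x) xs) ≡ + sum (map f xs)
sumℤ-map-pos f []       = refl
sumℤ-map-pos f (x ∷ xs) = trans (cong (λ s → + f x ℤ.+ s) (sumℤ-map-pos f xs)) (sym (pos-+ (f x) _))

module _ {n} (G : Graph n) (σ : Order n) (u : Fin n) where

  dist-shortest : ∀ {v δ r} → IsDist G σ u v δ → δ ≤ r → Σ (List (Fin n)) λ ps → IsShortestQual G σ r u (ps , v)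
  dist-shortest ((ps , chain , unique , length≤ , u≤v , internal) , minimal) δ≤r =
    ps , (chain , unique , ≤-trans length≤ δ≤r , u≤v , internal) , λ reach → <⇒≱ length≤ (minimal (length ps) reach)

  est-zero-unreachable : ∀ {v δ r} → EstAtMost G σ r u 0 → IsDist G σ u v δ → δ ≤ r → ⊥
  est-zero-unreachable {v} est dist δ≤r with dist-shortest dist δ≤r
  ... | ps , shortest with est ((ps , v) ∷ []) (shortest ∷ []) ([] ∷ [])
  ...   | ()

  module _ (r : ℕ) where

    module _ (Adj? : ∀ x y → Dec (Adj G x y)) where

      open BreadthFirstTree G σ Adj? u r

      dist-target : ∀ {v δ} → IsDist G σ u v δ → δ ≤ r → Target v × depth v ≡ δ
      dist-target {v} {δ} ((ps , qual@(_ , (u≢ ∷ _) , length≤ , u≤v , _)) , minimal) δ≤r = target , depth≡δ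
        where
        u<v : rank σ u ℕ.< rank σ v
        u<v = ≤∧≢⇒< u≤v λ eq → All.lookup u≢ (∈-++⁺ʳ ps (here refl)) (rank-inj σ eq)
        depth≤δ : depth v ≤ δ
        depth≤δ = ≤-trans (depth≤path-length qual) length≤
        target : Target v
        target = u<v , ≤-trans depth≤δ δ≤r
        depth≡δ : depth v ≡ δ
        depth≡δ = ≤-antisym depth≤δ (minimal (depth v) (tree-path (<⇒≤ u<v) (target-depth>0 target) (proj₂ target)))

      weighted-dist≤ : ∀ b → (∀ x → EstAtMost G σ r x (suc b)) → 1 ≤ r → ∀ {R} → Unique R → (d : Fin n → ℕ) →
                       All (λ v → IsDist G σ u v (d v) × d v ≤ r) R →
                       sum (map (λ v → b ℕ.^ (r ∸ d v)) R) ≤ suc b ℕ.* b ℕ.^ (r ∸ 1)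
      weighted-dist≤ b est 1≤r {R} R! d dists = subst (_≤ suc b ℕ.* b ℕ.^ (r ∸ 1))
        (cong sum (map-cong-local (All.map (λ (dist , δ≤r) → cong (λ δ → b ℕ.^ (r ∸ δ)) (proj₂ (dist-target dist δ≤r))) dists)))
        (weighted-targets≤ b est 1≤r R! (All.map (λ (dist , δ≤r) → proj₁ (dist-target dist δ≤r)) dists))

    weighted-dist≤ℤ : ∀ k → (∀ x → EstAtMost G σ r x k) → 1 ≤ r → ∀ {R} → Unique R → (d : Fin n → ℕ) →
                      All (λ v → IsDist G σ u v (d v) × d v ≤ r) R →
                      sumℤ (map (λ v → (+ k - + 1) ^ (r ∸ d v)) R) ≤ℤ + k * (+ k - + 1) ^ (r ∸ 1)
    weighted-dist≤ℤ zero est _ {R} _ d dists =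
      subst (λ R → sumℤ (map (λ v → (+ 0 - + 1) ^ (r ∸ d v)) R) ≤ℤ + 0 * (+ 0 - + 1) ^ (r ∸ 1))
        (sym (no-targets dists)) (ℤ.+≤+ z≤n)
      where
      no-targets : ∀ {L} → All (λ v → IsDist G σ u v (d v) × d v ≤ r) L → L ≡ []
      no-targets []                 = refl
      no-targets ((dist , δ≤r) ∷ _) = ⊥-elim (est-zero-unreachable (est u) dist δ≤r)
    -- Here + suc b - + 1 reduces to + b, so only the casts from ℕ remain.
    weighted-dist≤ℤ (suc b) est 1≤r {R} R! d dists = subst₂ _≤ℤ_ lhs≡ rhs≡ (ℤ.+≤+ (decidable-stable (_ ℕ.≤? _) λ ≰ →
      ¬¬-Adj-decidable G λ Adj? → ≰ (weighted-dist≤ Adj? b est 1≤r R! d dists)))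
      where
      lhs≡ : + sum (map (λ v → b ℕ.^ (r ∸ d v)) R) ≡ sumℤ (map (λ v → (+ b) ^ (r ∸ d v)) R)
      lhs≡ = trans (sym (sumℤ-map-pos (λ v → b ℕ.^ (r ∸ d v)) R)) (cong sumℤ (map-cong (λ v → pos-^ b (r ∸ d v)) R))
      rhs≡ : + (suc b ℕ.* b ℕ.^ (r ∸ 1)) ≡ + suc b * (+ b) ^ (r ∸ 1)
      rhs≡ = trans (pos-* (suc b) _) (cong (+ suc b *_) (pos-^ b (r ∸ 1)))

lemma9 : ∀ {n : ℕ} (G : Graph n) (r k : ℕ) → 1 ≤ r → IsAdm G r k →
         (σ : Order n) → (∀ (u : Fin n) → EstAtMost G σ r u k) →
         ∀ (u : Fin n) (R : List (Fin n)) → Unique R →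
         (∀ (v : Fin n) → (v ∈ R) ⇔ Reachable G σ r u v) →
         (d : Fin n → ℕ) → (∀ (v : Fin n) → v ∈ R → IsDist G σ u v (d v)) →
         sumℤ (map (λ v → (+ k - + 1) ^ (r ∸ d v)) R) ≤ℤ (+ k * ((+ k - + 1) ^ (r ∸ 1)))
lemma9 G r k 1≤r _ σ est u R R! R⇔reach d dists =
  weighted-dist≤ℤ G σ u r k est 1≤r R! d (All.tabulate λ {v} v∈ → dists v v∈ , d≤r v∈)
  where
  d≤r : ∀ {v} → v ∈ R → d v ≤ r
  d≤r {v} v∈ = proj₂ (dists v v∈) r (Equivalence.to (R⇔reach v) v∈)
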